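{- Let $r$ be a positive integer and let $G$ be a simple graph with $n$ vertices. Then $G$ has a cycle cover of size at most $r$ if and only if its $n$-closure $\operatorname{cl}_{n}(G)$ has a cycle cover of size at most $r$.
   Context: A cycle cover of a graph $G$ is a set of pairwise vertex-disjoint cycles of $G$ such that every vertex of $G$ lies in exactly one of these cycles, where a single vertex is considered a (trivial) cycle; every nontrivial cycle has at least three vertices. The size of a cycle cover is its number of cycles. For an integer $\ell$ and a graph $G$ with $n$ vertices, the $(n+\ell)$-closure $\operatorname{cl}_{n+\ell}(G)$ is the graph obtained from $G$ by repeatedly adding an edge between a pair of nonadjacent vertices whose degree sum (in the current graph) is at least $n+\ell$, until no such pair remains; this graph is uniquely determined by $G$ (Bondy–Chvátal). Here $\ell=0$. -}

module Defs where

open import Data.Nat using (ℕ; zero; suc; _+_; _≤_; _<_; _≥_)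
open import Data.Bool using (Bool; true; false; _∨_; _∧_; if_then_else_)
open import Data.Fin using (Fin; _≟_)
open import Data.List using (List; []; _∷_; _++_; [_]; length; map; concat; allFin)
open import Data.Nat.ListAction using (sum)
open import Data.Unit using (⊤)
open import Data.Empty using (⊥)
open import Data.List.Relation.Unary.All using (All)
open import Data.List.Relation.Binary.Permutation.Propositional using (_↭_)
open import Data.Product using (Σ; _×_; ∃-syntax)
open import Data.Sum using (_⊎_)
open import Relation.Nullary using (¬_)
open import Relation.Nullary.Decidable using (⌊_⌋)
open import Relation.Binary.PropositionalEquality using (_≡_; _≢_)

Graph : ℕ → Set
Graph n = Fin n → Fin n → Bool

record IsSimple {n : ℕ} (A : Graph n) : Set where
  field
    symmetric   : ∀ x y → A x y ≡ A y x
    irreflexive : ∀ x → A x x ≡ false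

deg : {n : ℕ} → Graph n → Fin n → ℕ
deg {n} A x = sum (map (λ y → if A x y then 1 else 0) (allFin n))

addEdge : {n : ℕ} → Graph n → Fin n → Fin n → Graph n
addEdge A u v x y =
  A x y ∨ ((⌊ x ≟ u ⌋ ∧ ⌊ y ≟ v ⌋) ∨ (⌊ x ≟ v ⌋ ∧ ⌊ y ≟ u ⌋))

data ClosureSeq {n : ℕ} (k : ℕ) : Graph n → Graph n → Set where
  done : ∀ {A} → ClosureSeq k A A
  step : ∀ {A B} (u v : Fin n) → u ≢ v → A u v ≡ false →
         k ≤ deg A u + deg A v →
         ClosureSeq k (addEdge A u v) B → ClosureSeq k A B

Closed : {n : ℕ} → ℕ → Graph n → Set
Closed k A = ∀ u v → u ≢ v → A u v ≡ false → deg A u + deg A v < k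

-- H is the k-closure cl_k(G) (unique by Bondy–Chvátal).
IsClosure : {n : ℕ} → ℕ → Graph n → Graph n → Set
IsClosure k G H = ClosureSeq k G H × Closed k H

Chain : {n : ℕ} → Graph n → List (Fin n) → Set
Chain A []            = ⊤
Chain A (x ∷ [])      = ⊤
Chain A (x ∷ y ∷ zs)  = (A x y ≡ true) × Chain A (y ∷ zs)

-- Distinctness of the vertices is
-- enforced by the cover condition below.
IsCycle : {n : ℕ} → Graph n → List (Fin n) → Set
IsCycle A []       = ⊥
IsCycle A (x ∷ xs) = (length xs ≡ 0) ⊎ ((2 ≤ length xs) × Chain A ((x ∷ xs) ++ [ x ]))

-- A cycle cover: a list of cycles such that every vertex lies in exactly one
-- of them exactly once (concatenation is a permutation of all vertices).
IsCycleCover : {n : ℕ} → Graph n → List (List (Fin n)) → Set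
IsCycleCover {n} A cs = All (IsCycle A) cs × (concat cs ↭ allFin n)

HasCycleCoverAtMost : {n : ℕ} → Graph n → ℕ → Set
HasCycleCoverAtMost A r = ∃[ cs ] (IsCycleCover A cs × length cs ≤ r)

-- Adding an edge can only help, so covers of G give covers of cl_n(G). Conversely it suffices to undo one
-- closure step: G + uv has a cover by at most r cycles and d(u) + d(v) ≥ n in G. Cycles avoiding the
-- edge uv are cycles of G; if the cycle through u uses uv, deleting it leaves a u–v path P. Call a
-- consecutive pair (a, b) of P a crossing if v ~ a and u ~ b: then u…a v…b u is a cycle of G on the
-- vertices of P. Call a cyclically consecutive pair (a, b) of another cycle D a crossing if u ~ a and
-- v ~ b: then P can be spliced with D into one cycle, saving a cycle. If there is no crossing, every
-- consecutive pair contributes at most one neighbour of u or v, so d(u) + d(v) ≤ (|P| − 1) + Σ |D| = n − 1.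
module Submission where

open import Algebra.Properties.CommutativeSemigroup using (interchange)
open import Data.Bool using (Bool; true; false; if_then_else_; _∨_; _∧_)
open import Data.Bool.Properties using (∨-comm; ∧-comm)
open import Data.Empty using (⊥-elim)
open import Data.Fin using (Fin; _≟_)
open import Data.List
  using (List; []; _∷_; _++_; [_]; _∷ʳ_; length; map; concat; reverse; allFin; initLast; _∷ʳ′_)
open import Data.List.Properties
  using (++-assoc; ++-identityʳ; length-++; length-++-sucʳ; length-++-comm; length-tabulate; map-++;
         reverse-++; unfold-reverse; ∷ʳ-injective; ∷ʳ-injectiveˡ)
open import Data.List.Membership.Propositional using (_∈_; _∉_)
open import Data.List.Membership.Propositional.Properties
  using (∈-allFin; ∈-++⁻; ∈-++⁺ˡ; ∈-++⁺ʳ; ∈-concat⁻′; ∈-∃++)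
open import Data.List.Relation.Binary.Permutation.Propositional
  using (_↭_; ↭-refl; ↭-trans; ↭-sym; ↭-reflexive; ↭⇒↭ₛ)
import Data.List.Relation.Binary.Permutation.Propositional as Perm
open import Data.List.Relation.Binary.Permutation.Propositional.Properties
  using (++-comm; ++⁺ˡ; ++⁺ʳ; shifts; shift; map⁺; ↭-reverse; ∷↭∷ʳ; ↭-length; ∈-resp-↭; All-resp-↭)
import Data.List.Relation.Binary.Permutation.Setoid.Properties as PermSetoid
open import Data.List.Relation.Unary.All using (All; []; _∷_)
import Data.List.Relation.Unary.All as All
import Data.List.Relation.Unary.All.Properties as All
open import Data.List.Relation.Unary.AllPairs using ([]; _∷_)
open import Data.List.Relation.Unary.Any using (here; there)
open import Data.List.Relation.Unary.Unique.Propositional using (Unique)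
open import Data.List.Relation.Unary.Unique.Propositional.Properties using (Unique[x∷xs]⇒x∉xs; allFin⁺)
open import Data.Nat using (ℕ; suc; _+_; _≤_; _<_; z≤n; s≤s)
open import Data.Nat.ListAction using (sum)
open import Data.Nat.ListAction.Properties using (sum-++; sum-↭)
open import Data.Nat.Properties
  using (≤-reflexive; ≤-trans; n≤1+n; <⇒≱; +-identityʳ; +-comm; +-mono-≤; +-commutativeSemigroup;
         module ≤-Reasoning)
open import Data.Product using (∃-syntax; _×_; _,_)
open import Data.Sum using (_⊎_; inj₁; inj₂)
open import Data.Unit using (tt)
open import Function using (_∘_; id)
open import Function.Bundles using (_⇔_; mk⇔)
open import Relation.Binary.PropositionalEquality
  using (_≡_; _≢_; refl; sym; trans; cong; cong₂; subst; setoid)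
open import Relation.Nullary using (yes; no)
open import Relation.Nullary.Decidable using (⌊_⌋)

open import Defs

+-interchange-≤ : ∀ a b c d {k m} → a + b ≤ k → c + d ≤ m → (a + c) + (b + d) ≤ k + m
+-interchange-≤ a b c d {k} {m} ab≤k cd≤m =
  subst (_≤ k + m) (interchange +-commutativeSemigroup a b c d) (+-mono-≤ ab≤k cd≤m)

both-true-or-≤1 : ∀ b c → (b ≡ true × c ≡ true) ⊎ (if b then 1 else 0) + (if c then 1 else 0) ≤ 1
both-true-or-≤1 true  true  = inj₁ (refl , refl)
both-true-or-≤1 true  false = inj₂ (s≤s z≤n)
both-true-or-≤1 false true  = inj₂ (s≤s z≤n)
both-true-or-≤1 false false = inj₂ z≤n

length≥2 : ∀ {a} {X : Set a} (xs : List X) {y z zs} → 2 ≤ length (xs ++ y ∷ z ∷ zs)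
length≥2 []       = s≤s (s≤s z≤n)
length≥2 (x ∷ xs) = ≤-trans (length≥2 xs) (n≤1+n _)

module _ {a} {X : Set a} where

  consecutive-∷ʳ⁻ : ∀ pre {x y : X} post {xs z} → pre ++ x ∷ y ∷ post ≡ xs ∷ʳ z →
                    (y ≡ z × pre ∷ʳ x ≡ xs) ⊎ ∃[ post′ ] pre ++ x ∷ y ∷ post′ ≡ xs
  consecutive-∷ʳ⁻ pre {x} {y} post {xs} eq with initLast post
  ... | [] with ∷ʳ-injective (pre ∷ʳ x) xs (trans (++-assoc pre [ x ] [ y ]) eq)
  ...   | pre∷ʳx≡xs , y≡z = inj₁ (y≡z , pre∷ʳx≡xs)
  consecutive-∷ʳ⁻ pre {x} {y} post {xs} eq | post′ ∷ʳ′ _ =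
    inj₂ (post′ , ∷ʳ-injectiveˡ (pre ++ x ∷ y ∷ post′) xs (trans (++-assoc pre (x ∷ y ∷ post′) _) eq))

  reverse-∷-∷ʳ : ∀ (x : X) xs y → reverse (x ∷ xs ∷ʳ y) ≡ y ∷ reverse xs ∷ʳ x
  reverse-∷-∷ʳ x xs y = trans (unfold-reverse x (xs ∷ʳ y)) (cong (_∷ʳ x) (reverse-++ xs [ y ]))

  ∉-∷ʳ : ∀ {x y : X} {xs} → x ∉ xs → x ≢ y → x ∉ xs ∷ʳ y
  ∉-∷ʳ {xs = xs} x∉xs x≢y x∈ with ∈-++⁻ xs x∈
  ... | inj₁ x∈xs       = x∉xs x∈xs
  ... | inj₂ (here x≡y) = x≢y x≡y

  concat-↭ : {xss yss : List (List X)} → xss ↭ yss → concat xss ↭ concat yss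
  concat-↭ Perm.refl           = ↭-refl
  concat-↭ (Perm.prep xs p)    = ++⁺ˡ xs (concat-↭ p)
  concat-↭ (Perm.swap xs ys p) = ↭-trans (shifts xs ys) (++⁺ˡ ys (++⁺ˡ xs (concat-↭ p)))
  concat-↭ (Perm.trans p q)    = ↭-trans (concat-↭ p) (concat-↭ q)

  ∈-concat-focus : ∀ {x : X} xss → x ∈ concat xss → ∃[ xs ] ∃[ yss ] x ∈ xs × xss ↭ xs ∷ yss
  ∈-concat-focus xss x∈ with ∈-concat⁻′ xss x∈
  ... | xs , x∈xs , xs∈xss with ∈-∃++ xs∈xss
  ...   | yss₁ , yss₂ , xss≡ = xs , yss₁ ++ yss₂ , x∈xs , ↭-trans (↭-reflexive xss≡) (shift xs yss₁ yss₂)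

  Unique-resp-↭ : {xs ys : List X} → xs ↭ ys → Unique xs → Unique ys
  Unique-resp-↭ p = PermSetoid.Unique-resp-↭ (setoid X) (↭⇒↭ₛ p)

  Unique-++⁻ˡ : ∀ xs {ys : List X} → Unique (xs ++ ys) → Unique xs
  Unique-++⁻ˡ []       _           = []
  Unique-++⁻ˡ (x ∷ xs) (x∉ ∷ uniq) = All.++⁻ˡ xs x∉ ∷ Unique-++⁻ˡ xs uniq

  Unique-∉-middle : ∀ xs {x : X} {ys} → Unique (xs ++ x ∷ ys) → x ∉ xs ++ ys
  Unique-∉-middle []           uniq                   = Unique[x∷xs]⇒x∉xs uniq
  Unique-∉-middle (z ∷ zs)     (z≢ ∷ _)    (here x≡z) = All.lookup z≢ (∈-++⁺ʳ zs (here refl)) (sym x≡z)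
  Unique-∉-middle (z ∷ zs)     (_ ∷ uniq)  (there x∈) = Unique-∉-middle zs uniq x∈

  -- deg A x is definitionally count (A x) (allFin n).
  indicator : (X → Bool) → X → ℕ
  indicator p x = if p x then 1 else 0

  count : (X → Bool) → List X → ℕ
  count p xs = sum (map (indicator p) xs)

  count-++ : ∀ p xs {ys} → count p (xs ++ ys) ≡ count p xs + count p ys
  count-++ p xs {ys} = trans (cong sum (map-++ (indicator p) xs ys)) (sum-++ (map (indicator p) xs) _)

  count-↭ : ∀ p {xs ys} → xs ↭ ys → count p xs ≡ count p ys
  count-↭ p xs↭ys = sum-↭ (map⁺ _ xs↭ys)

  count-∷-false : ∀ p {x} xs → p x ≡ false → count p (x ∷ xs) ≡ count p xs
  count-∷-false p xs px rewrite px = refl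

  count-∷ʳ-false : ∀ p xs {y} → p y ≡ false → count p (xs ∷ʳ y) ≡ count p xs
  count-∷ʳ-false p xs py =
    trans (count-++ p xs) (trans (cong (count p xs +_) (count-∷-false p [] py)) (+-identityʳ _))

  Crossing : (p q : X → Bool) → List X → Set a
  Crossing p q xs = ∃[ pre ] ∃[ x ] ∃[ y ] ∃[ post ] xs ≡ pre ++ x ∷ y ∷ post × p x ≡ true × q y ≡ true

  crossing-or-count : ∀ p q x ys y → Crossing p q (x ∷ ys ∷ʳ y) ⊎
                      count p (x ∷ ys) + count q (ys ∷ʳ y) ≤ suc (length ys)
  crossing-or-count p q x [] y with both-true-or-≤1 (p x) (q y)
  ... | inj₁ (px , qy) = inj₁ ([] , x , y , [] , refl , px , qy)
  ... | inj₂ ≤1        = inj₂ (+-interchange-≤ (indicator p x) (indicator q y) 0 0 ≤1 z≤n)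
  crossing-or-count p q x (z ∷ zs) y with both-true-or-≤1 (p x) (q z)
  ... | inj₁ (px , qz) = inj₁ ([] , x , z , zs ∷ʳ y , refl , px , qz)
  ... | inj₂ ≤1 with crossing-or-count p q z zs y
  ...   | inj₁ (pre , a , b , post , eq , pa , qb) = inj₁ (x ∷ pre , a , b , post , cong (x ∷_) eq , pa , qb)
  ...   | inj₂ ≤len = inj₂ (+-interchange-≤ (indicator p x) (indicator q z) _ _ ≤1 ≤len)

module _ {n} {A : Graph n} where

  Chain-++⁻ˡ : ∀ xs {ys} → Chain A (xs ++ ys) → Chain A xs
  Chain-++⁻ˡ []           _        = tt
  Chain-++⁻ˡ (x ∷ [])     _        = tt
  Chain-++⁻ˡ (x ∷ y ∷ xs) (e , ch) = e , Chain-++⁻ˡ (y ∷ xs) ch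

  Chain-split : ∀ xs {y} ys → Chain A (xs ++ y ∷ ys) → Chain A (xs ∷ʳ y) × Chain A (y ∷ ys)
  Chain-split []            ys ch       = tt , ch
  Chain-split (x ∷ [])      ys (e , ch) = (e , tt) , ch
  Chain-split (x ∷ x′ ∷ xs) ys (e , ch) with Chain-split (x′ ∷ xs) ys ch
  ... | left , right = (e , left) , right

  Chain-join : ∀ xs {y} ys → Chain A (xs ∷ʳ y) → Chain A (y ∷ ys) → Chain A (xs ++ y ∷ ys)
  Chain-join []            ys _          right = right
  Chain-join (x ∷ [])      ys (e , _)    right = e , right
  Chain-join (x ∷ x′ ∷ xs) ys (e , left) right = e , Chain-join (x′ ∷ xs) ys left right

  Chain-snoc : ∀ xs {y z} → Chain A (xs ∷ʳ y) → A y z ≡ true → Chain A (xs ∷ʳ y ∷ʳ z)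
  Chain-snoc xs {y} {z} ch e = subst (Chain A) (sym (++-assoc xs [ y ] [ z ])) (Chain-join xs [ z ] ch (e , tt))

  Chain-mono : ∀ {B : Graph n} → (∀ {x y} → A x y ≡ true → B x y ≡ true) → ∀ xs → Chain A xs → Chain B xs
  Chain-mono A⊆B []           _        = tt
  Chain-mono A⊆B (x ∷ [])     _        = tt
  Chain-mono A⊆B (x ∷ y ∷ xs) (e , ch) = A⊆B e , Chain-mono A⊆B (y ∷ xs) ch

  Chain-reverse : (∀ x y → A x y ≡ A y x) → ∀ xs → Chain A xs → Chain A (reverse xs)
  Chain-reverse sym-A []           _        = tt
  Chain-reverse sym-A (x ∷ [])     _        = tt
  Chain-reverse sym-A (x ∷ y ∷ xs) (e , ch) =
    subst (Chain A) (sym reverse≡)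
      (Chain-join (reverse xs) [ x ] (subst (Chain A) (unfold-reverse y xs) (Chain-reverse sym-A (y ∷ xs) ch))
        (trans (sym-A y x) e , tt))
    where
    reverse≡ : reverse (x ∷ y ∷ xs) ≡ reverse xs ++ y ∷ [ x ]
    reverse≡ = trans (unfold-reverse x (y ∷ xs))
                 (trans (cong (_∷ʳ x) (unfold-reverse y xs)) (++-assoc (reverse xs) [ y ] [ x ]))

  IsCycle→Chain : ∀ {x} xs → IsCycle A (x ∷ xs) → Chain A (x ∷ xs)
  IsCycle→Chain []               _               = tt
  IsCycle→Chain (_ ∷ _)          (inj₁ ())
  IsCycle→Chain {x} xs@(_ ∷ _)  (inj₂ (_ , ch)) = Chain-++⁻ˡ (x ∷ xs) ch

  IsCycle-mono : ∀ {B : Graph n} → (∀ {x y} → A x y ≡ true → B x y ≡ true) → ∀ xs → IsCycle A xs → IsCycle B xs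
  IsCycle-mono A⊆B (x ∷ xs) (inj₁ len≡0)        = inj₁ len≡0
  IsCycle-mono A⊆B (x ∷ xs) (inj₂ (len≥2 , ch)) = inj₂ (len≥2 , Chain-mono A⊆B (x ∷ xs ∷ʳ x) ch)

  IsCycle-arcs : ∀ {x y} L M → IsCycle A (x ∷ L ++ y ∷ M) →
                 2 ≤ length (L ++ y ∷ M) × Chain A (x ∷ L ∷ʳ y) × Chain A (y ∷ M ∷ʳ x)
  IsCycle-arcs {y = y} L M (inj₁ len≡0) with () ← trans (sym (length-++-sucʳ L y M)) len≡0
  IsCycle-arcs {x} {y} L M (inj₂ (len≥2 , ch)) =
    len≥2 , Chain-split (x ∷ L) (M ∷ʳ x) (subst (Chain A) (cong (x ∷_) (++-assoc L (y ∷ M) [ x ])) ch)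

  IsCycle-rotate : ∀ xs {y} ys → IsCycle A (xs ++ y ∷ ys) → IsCycle A (y ∷ ys ++ xs)
  IsCycle-rotate []           {y} ys cyc = subst (λ zs → IsCycle A (y ∷ zs)) (sym (++-identityʳ ys)) cyc
  IsCycle-rotate (x ∷ xs) {y} ys cyc with len≥2 , arc₁ , arc₂ ← IsCycle-arcs xs ys cyc =
    inj₂ (subst (2 ≤_) (trans (length-++-sucʳ xs y ys) (sym (length-++-comm ys (x ∷ xs)))) len≥2 ,
          subst (Chain A) (cong (y ∷_) (sym (++-assoc ys (x ∷ xs) [ y ])))
            (Chain-join (y ∷ ys) (xs ∷ʳ y) arc₂ arc₁))

  IsCycle-open-at-crossing : ∀ {u v a b} x xs pre post → IsCycle A (x ∷ xs) →
                             x ∷ xs ∷ʳ x ≡ pre ++ a ∷ b ∷ post → A v b ≡ true → A a u ≡ true →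
                             ∃[ R ] R ↭ x ∷ xs × Chain A (v ∷ R ∷ʳ u)
  IsCycle-open-at-crossing {u} {v} {a} {b} x xs pre post cyc eq vb au
    with consecutive-∷ʳ⁻ pre post {x ∷ xs} {x} (sym eq)
  ... | inj₁ (refl , pre∷ʳa≡) =
    x ∷ xs , ↭-refl ,
    vb , subst (λ t → Chain A (t ∷ʳ u)) pre∷ʳa≡
           (Chain-snoc pre (subst (Chain A) (sym pre∷ʳa≡) (IsCycle→Chain xs cyc)) au)
  ... | inj₂ (post′ , pre++post′≡) =
    (b ∷ post′ ++ pre) ∷ʳ a ,
    ↭-trans (++-comm (b ∷ post′ ++ pre) [ a ])
      (↭-trans (++-comm (a ∷ b ∷ post′) pre) (↭-reflexive pre++post′≡)) ,
    vb , Chain-snoc (b ∷ post′ ++ pre) arc au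
    where
    rotated : IsCycle A (b ∷ post′ ++ pre ∷ʳ a)
    rotated = IsCycle-rotate (pre ∷ʳ a) post′
                (subst (IsCycle A) (trans (sym pre++post′≡) (sym (++-assoc pre [ a ] (b ∷ post′)))) cyc)
    arc : Chain A ((b ∷ post′ ++ pre) ∷ʳ a)
    arc = subst (Chain A) (cong (b ∷_) (sym (++-assoc post′ pre [ a ])))
            (IsCycle→Chain (post′ ++ pre ∷ʳ a) rotated)

  Chain-close-at-crossing : (∀ x y → A x y ≡ A y x) → ∀ {u v a b} pre post →
                            Chain A (u ∷ pre ++ a ∷ b ∷ post ∷ʳ v) → A a v ≡ true → A b u ≡ true →
                            IsCycle A (u ∷ pre ++ a ∷ v ∷ reverse post ∷ʳ b)
  Chain-close-at-crossing sym-A {u} {v} {a} {b} pre post path av bu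
    with to-a , (_ , from-b) ← Chain-split (u ∷ pre) (b ∷ post ∷ʳ v) path =
    inj₂ (length≥2 pre ,
          subst (Chain A) (cong (u ∷_) (sym closed≡))
            (Chain-join (u ∷ pre) _ to-a (av , Chain-join (v ∷ reverse post) [ u ] back-to-b (bu , tt))))
    where
    back-to-b : Chain A (v ∷ reverse post ∷ʳ b)
    back-to-b = subst (Chain A) (reverse-∷-∷ʳ b post v) (Chain-reverse sym-A (b ∷ post ∷ʳ v) from-b)
    closed≡ : (pre ++ a ∷ v ∷ reverse post ∷ʳ b) ∷ʳ u ≡ pre ++ a ∷ v ∷ reverse post ++ b ∷ [ u ]
    closed≡ = trans (++-assoc pre _ [ u ]) (cong (λ t → pre ++ a ∷ v ∷ t) (++-assoc (reverse post) [ b ] [ u ]))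

HasCycleCoverAtMost-mono : ∀ {n} {A B : Graph n} {r} → (∀ {x y} → A x y ≡ true → B x y ≡ true) →
                           HasCycleCoverAtMost A r → HasCycleCoverAtMost B r
HasCycleCoverAtMost-mono A⊆B (cs , (cycs , cs↭) , cs≤r) = cs , (All.map (IsCycle-mono A⊆B _) cycs , cs↭) , cs≤r

addEdge-⊇ : ∀ {n} (A : Graph n) u v {x y} → A x y ≡ true → addEdge A u v x y ≡ true
addEdge-⊇ A u v e rewrite e = refl

addEdge-isSimple : ∀ {n} {A : Graph n} {u v} → u ≢ v → IsSimple A → IsSimple (addEdge A u v)
addEdge-isSimple {A = A} {u} {v} u≢v simple = record
  { symmetric   = λ x y → cong₂ _∨_ (symmetric x y) (new-edge-symmetric x y)
  ; irreflexive = irreflexive⁺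
  }
  where
  open IsSimple simple
  new-edge-symmetric : ∀ x y → (⌊ x ≟ u ⌋ ∧ ⌊ y ≟ v ⌋) ∨ (⌊ x ≟ v ⌋ ∧ ⌊ y ≟ u ⌋) ≡
                               (⌊ y ≟ u ⌋ ∧ ⌊ x ≟ v ⌋) ∨ (⌊ y ≟ v ⌋ ∧ ⌊ x ≟ u ⌋)
  new-edge-symmetric x y =
    trans (∨-comm (⌊ x ≟ u ⌋ ∧ ⌊ y ≟ v ⌋) _) (cong₂ _∨_ (∧-comm ⌊ x ≟ v ⌋ _) (∧-comm ⌊ x ≟ u ⌋ _))
  irreflexive⁺ : ∀ x → addEdge A u v x x ≡ false
  irreflexive⁺ x rewrite irreflexive x with x ≟ u | x ≟ v
  ... | yes refl | yes x≡v = ⊥-elim (u≢v x≡v)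
  ... | yes _    | no _    = refl
  ... | no _     | yes _   = refl
  ... | no _     | no _    = refl

HasPathCycleCoverAtMost : ∀ {n} → Graph n → Fin n → Fin n → ℕ → Set
HasPathCycleCoverAtMost {n} A u v r = ∃[ qs ] ∃[ ds ]
  Chain A (u ∷ qs ∷ʳ v) × All (IsCycle A) ds × (u ∷ qs ∷ʳ v) ++ concat ds ↭ allFin n × suc (length ds) ≤ r

module Lowering {n} (A : Graph n) (sym-A : ∀ x y → A x y ≡ A y x) (u v : Fin n) (u≢v : u ≢ v) where

  open import Data.List.Membership.DecPropositional (_≟_ {n}) using (_∈?_)

  A⁺ : Graph n
  A⁺ = addEdge A u v

  NewEdge : Fin n → Fin n → Set
  NewEdge x y = (x ≡ u × y ≡ v) ⊎ (x ≡ v × y ≡ u)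

  Endpoint : Fin n → Set
  Endpoint w = w ≡ u ⊎ w ≡ v

  NewEdge-endpoints : ∀ {x y} → NewEdge x y → Endpoint x × Endpoint y × x ≢ y
  NewEdge-endpoints (inj₁ (refl , refl)) = inj₁ refl , inj₂ refl , u≢v
  NewEdge-endpoints (inj₂ (refl , refl)) = inj₂ refl , inj₁ refl , u≢v ∘ sym

  addEdge⁻ : ∀ {x y} → A⁺ x y ≡ true → A x y ≡ true ⊎ NewEdge x y
  addEdge⁻ {x} {y} e with A x y | x ≟ u | y ≟ v | x ≟ v | y ≟ u
  ... | true  | _       | _       | _       | _       = inj₁ refl
  ... | false | yes x≡u | yes y≡v | _       | _       = inj₂ (inj₁ (x≡u , y≡v))
  ... | false | _       | _       | yes x≡v | yes y≡u = inj₂ (inj₂ (x≡v , y≡u))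
  addEdge⁻ () | false | no _  | _    | no _  | _
  addEdge⁻ () | false | no _  | _    | yes _ | no _
  addEdge⁻ () | false | yes _ | no _ | no _  | _
  addEdge⁻ () | false | yes _ | no _ | yes _ | no _

  edge-lower : ∀ {w x y} → Endpoint w → x ≢ w → y ≢ w → A⁺ x y ≡ true → A x y ≡ true
  edge-lower end x≢w y≢w e with addEdge⁻ e | end
  ... | inj₁ e′                 | _         = e′
  ... | inj₂ (inj₁ (refl , _)) | inj₁ refl = ⊥-elim (x≢w refl)
  ... | inj₂ (inj₁ (_ , refl)) | inj₂ refl = ⊥-elim (y≢w refl)
  ... | inj₂ (inj₂ (refl , _)) | inj₂ refl = ⊥-elim (x≢w refl)
  ... | inj₂ (inj₂ (_ , refl)) | inj₁ refl = ⊥-elim (y≢w refl)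

  Chain-lower : ∀ {w} → Endpoint w → ∀ xs → w ∉ xs → Chain A⁺ xs → Chain A xs
  Chain-lower end []           _  _        = tt
  Chain-lower end (x ∷ [])     _  _        = tt
  Chain-lower end (x ∷ y ∷ xs) w∉ (e , ch) =
    edge-lower end (λ x≡w → w∉ (here (sym x≡w))) (λ y≡w → w∉ (there (here (sym y≡w)))) e ,
    Chain-lower end (y ∷ xs) (w∉ ∘ there) ch

  IsCycle-lower : ∀ {w} → Endpoint w → ∀ xs → w ∉ xs → IsCycle A⁺ xs → IsCycle A xs
  IsCycle-lower end (x ∷ xs) w∉ (inj₁ len≡0)        = inj₁ len≡0
  IsCycle-lower end (x ∷ xs) w∉ (inj₂ (len≥2 , ch)) =
    inj₂ (len≥2 , Chain-lower end (x ∷ xs ∷ʳ x) (∉-∷ʳ w∉ (w∉ ∘ here)) ch)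

  arc-lower : ∀ {x y l} ls → NewEdge x y → x ∉ l ∷ ls → y ∉ l ∷ ls →
              Chain A⁺ (x ∷ l ∷ ls ∷ʳ y) → Chain A (x ∷ l ∷ ls ∷ʳ y)
  arc-lower {y = y} {l} ls new x∉ y∉ (e , ch) with x-end , y-end , x≢y ← NewEdge-endpoints new =
    edge-lower y-end x≢y (λ l≡y → y∉ (here (sym l≡y))) e ,
    Chain-lower x-end (l ∷ ls ∷ʳ y) (∉-∷ʳ x∉ x≢y) ch

  CycleOrPath : List (Fin n) → Set
  CycleOrPath ws = IsCycle A (u ∷ ws) ⊎ ∃[ qs ] u ∷ qs ∷ʳ v ↭ u ∷ ws × Chain A (u ∷ qs ∷ʳ v)

  arcs-avoid-ends : ∀ L {M} → Unique (u ∷ L ++ v ∷ M) → (u ∉ L × v ∉ L) × (v ∉ M × u ∉ M)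
  arcs-avoid-ends L uniq =
    (u∉ ∘ ∈-++⁺ˡ , v∉ ∘ there ∘ ∈-++⁺ˡ) , (v∉ ∘ there ∘ ∈-++⁺ʳ L , u∉ ∘ ∈-++⁺ʳ L ∘ there)
    where
    u∉ = Unique[x∷xs]⇒x∉xs uniq
    v∉ = Unique-∉-middle (u ∷ L) uniq

  two-arcs-lower : ∀ L M → Unique (u ∷ L ++ v ∷ M) → 2 ≤ length (L ++ v ∷ M) →
                   Chain A⁺ (u ∷ L ∷ʳ v) → Chain A⁺ (v ∷ M ∷ʳ u) → CycleOrPath (L ++ v ∷ M)
  two-arcs-lower [] [] _ (s≤s ()) _ _
  two-arcs-lower [] (m ∷ ms) uniq _ _ arc with _ , (v∉M , u∉M) ← arcs-avoid-ends [] uniq =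
    inj₂ (reverse (m ∷ ms) , reversed↭ ,
          subst (Chain A) (reverse-∷-∷ʳ v (m ∷ ms) u)
            (Chain-reverse sym-A (v ∷ m ∷ ms ∷ʳ u) (arc-lower ms (inj₂ (refl , refl)) v∉M u∉M arc)))
    where
    reversed↭ : u ∷ reverse (m ∷ ms) ∷ʳ v ↭ u ∷ v ∷ m ∷ ms
    reversed↭ = ↭-trans (↭-reflexive (sym (reverse-∷-∷ʳ v (m ∷ ms) u)))
                  (↭-trans (↭-reverse (v ∷ m ∷ ms ∷ʳ u)) (↭-sym (∷↭∷ʳ u (v ∷ m ∷ ms))))
  two-arcs-lower (l ∷ ls) [] uniq _ arc _ with (u∉L , v∉L) , _ ← arcs-avoid-ends (l ∷ ls) uniq =
    inj₂ (l ∷ ls , ↭-refl , arc-lower ls (inj₁ (refl , refl)) u∉L v∉L arc)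
  two-arcs-lower (l ∷ ls) (m ∷ ms) uniq len≥2 arc₁ arc₂
    with (u∉L , v∉L) , (v∉M , u∉M) ← arcs-avoid-ends (l ∷ ls) uniq =
    inj₁ (inj₂ (len≥2 , subst (Chain A) (cong (u ∷_) (sym (++-assoc (l ∷ ls) (v ∷ m ∷ ms) [ u ])))
                          (Chain-join (u ∷ l ∷ ls) (m ∷ ms ∷ʳ u)
                            (arc-lower ls (inj₁ (refl , refl)) u∉L v∉L arc₁)
                            (arc-lower ms (inj₂ (refl , refl)) v∉M u∉M arc₂))))

  cycle-through-u-lower : ∀ ws → Unique (u ∷ ws) → IsCycle A⁺ (u ∷ ws) → CycleOrPath ws
  cycle-through-u-lower ws uniq cyc with v ∈? ws
  ... | no v∉ws = inj₁ (IsCycle-lower (inj₂ refl) (u ∷ ws) v∉ cyc)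
    where
    v∉ : v ∉ u ∷ ws
    v∉ (here v≡u) = u≢v (sym v≡u)
    v∉ (there v∈) = v∉ws v∈
  ... | yes v∈ws with L , M , refl ← ∈-∃++ v∈ws with len≥2 , arc₁ , arc₂ ← IsCycle-arcs L M cyc =
    two-arcs-lower L M uniq len≥2 arc₁ arc₂

  cycles-avoiding-u-lower : ∀ ds → u ∉ concat ds → All (IsCycle A⁺) ds → All (IsCycle A) ds
  cycles-avoiding-u-lower []       _  []           = []
  cycles-avoiding-u-lower (d ∷ ds) u∉ (cyc ∷ cycs) =
    IsCycle-lower (inj₁ refl) d (u∉ ∘ ∈-++⁺ˡ) cyc ∷ cycles-avoiding-u-lower ds (u∉ ∘ ∈-++⁺ʳ d) cycs

  cover-lower : ∀ {r} → HasCycleCoverAtMost A⁺ r → HasCycleCoverAtMost A r ⊎ HasPathCycleCoverAtMost A u v r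
  cover-lower {r} (cs , (cycs , cs↭) , cs≤r)
    with c , others , u∈c , cs↭c∷others ← ∈-concat-focus cs (∈-resp-↭ (↭-sym cs↭) (∈-allFin u))
    with pre , post , refl ← ∈-∃++ u∈c
    = lift (cycle-through-u-lower (post ++ pre) (Unique-++⁻ˡ (u ∷ post ++ pre) uniq) rotated)
    where
    cycs′ : All (IsCycle A⁺) ((pre ++ u ∷ post) ∷ others)
    cycs′ = All-resp-↭ cs↭c∷others cycs
    rotated : IsCycle A⁺ (u ∷ post ++ pre)
    rotated = IsCycle-rotate pre post (All.head cycs′)
    cover↭ : (u ∷ post ++ pre) ++ concat others ↭ allFin n
    cover↭ = ↭-trans
               (++⁺ʳ (concat others) (↭-trans (Perm.prep u (++-comm post pre)) (↭-sym (shift u pre post))))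
               (↭-trans (concat-↭ (↭-sym cs↭c∷others)) cs↭)
    uniq : Unique ((u ∷ post ++ pre) ++ concat others)
    uniq = Unique-resp-↭ (↭-sym cover↭) (allFin⁺ n)
    others-lower : All (IsCycle A) others
    others-lower = cycles-avoiding-u-lower others
      (λ u∈ → Unique-∉-middle [] uniq (∈-++⁺ʳ (post ++ pre) u∈)) (All.tail cycs′)
    others≤r : suc (length others) ≤ r
    others≤r = subst (_≤ r) (↭-length cs↭c∷others) cs≤r
    lift : CycleOrPath (post ++ pre) → HasCycleCoverAtMost A r ⊎ HasPathCycleCoverAtMost A u v r
    lift (inj₁ cyc) = inj₁ ((u ∷ post ++ pre) ∷ others , (cyc ∷ others-lower , cover↭) , others≤r)
    lift (inj₂ (qs , qs↭ , path)) =
      inj₂ (qs , others , path , others-lower , ↭-trans (++⁺ʳ (concat others) qs↭) cover↭ , others≤r)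

module Closing {n} (A : Graph n) (simple : IsSimple A) (u v : Fin n) (u≁v : A u v ≡ false) where

  open IsSimple simple

  edge-sym : ∀ {x y} → A x y ≡ true → A y x ≡ true
  edge-sym {x} {y} = trans (symmetric y x)

  v≁u : A v u ≡ false
  v≁u = trans (symmetric v u) u≁v

  close-path : ∀ qs → Chain A (u ∷ qs ∷ʳ v) → Crossing (A v) (A u) (u ∷ qs ∷ʳ v) →
               ∃[ C ] C ↭ u ∷ qs ∷ʳ v × IsCycle A C
  close-path qs path (pre , a , b , post , eq , va , ub) with consecutive-∷ʳ⁻ pre post {u ∷ qs} {v} (sym eq)
  ... | inj₁ (refl , _) with () ← trans (sym ub) u≁v
  ... | inj₂ (post′ , pre++post′≡) with pre | pre++post′≡
  ...   | []       | refl with () ← trans (sym va) v≁u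
  ...   | _ ∷ pre′ | refl =
    u ∷ pre′ ++ a ∷ v ∷ reverse post′ ∷ʳ b ,
    Perm.prep u (↭-trans (++⁺ˡ pre′ (Perm.prep a reversed↭)) (↭-reflexive (sym path≡))) ,
    Chain-close-at-crossing symmetric pre′ post′ (subst (Chain A) (cong (u ∷_) path≡) path)
      (edge-sym va) (edge-sym ub)
    where
    path≡ : (pre′ ++ a ∷ b ∷ post′) ∷ʳ v ≡ pre′ ++ a ∷ b ∷ post′ ∷ʳ v
    path≡ = ++-assoc pre′ (a ∷ b ∷ post′) [ v ]
    reversed↭ : v ∷ reverse post′ ∷ʳ b ↭ b ∷ post′ ∷ʳ v
    reversed↭ = ↭-trans (↭-reflexive (sym (reverse-∷-∷ʳ b post′ v))) (↭-reverse (b ∷ post′ ∷ʳ v))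

  Splice : List (Fin n) → Set
  Splice D = ∃[ R ] R ↭ D × Chain A (v ∷ R ∷ʳ u)

  -- On the closed walk x ∷ xs ∷ʳ x, crossing-or-count counts the |D| cyclically consecutive pairs of D.
  splice-or-count : ∀ D → IsCycle A D → Splice D ⊎ count (A u) D + count (A v) D ≤ length D
  splice-or-count (x ∷ xs) cyc with crossing-or-count (A u) (A v) x xs x
  ... | inj₁ (pre , a , b , post , eq , ua , vb) =
    inj₁ (IsCycle-open-at-crossing x xs pre post cyc eq vb (edge-sym ua))
  ... | inj₂ ≤len = inj₂ (subst (λ k → count (A u) (x ∷ xs) + k ≤ suc (length xs))
                                (count-↭ (A v) (↭-sym (∷↭∷ʳ x xs))) ≤len)

  splices-or-count : ∀ ds → All (IsCycle A) ds →
                     (∃[ D ] ∃[ others ] ds ↭ D ∷ others × Splice D) ⊎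
                     count (A u) (concat ds) + count (A v) (concat ds) ≤ length (concat ds)
  splices-or-count []       []           = inj₂ z≤n
  splices-or-count (D ∷ ds) (cyc ∷ cycs) with splice-or-count D cyc
  ... | inj₁ splice = inj₁ (D , ds , ↭-refl , splice)
  ... | inj₂ ≤len with splices-or-count ds cycs
  ...   | inj₁ (D′ , others , ds↭ , splice) =
    inj₁ (D′ , D ∷ others , ↭-trans (Perm.prep D ds↭) (Perm.swap D D′ ↭-refl) , splice)
  ...   | inj₂ ≤len′
    rewrite count-++ (A u) D {concat ds} | count-++ (A v) D {concat ds} | length-++ D {concat ds} =
    inj₂ (+-interchange-≤ (count (A u) D) (count (A v) D) _ _ ≤len ≤len′)

  degree-sum< : ∀ qs ds → (u ∷ qs ∷ʳ v) ++ concat ds ↭ allFin n →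
                count (A v) (u ∷ qs) + count (A u) (qs ∷ʳ v) ≤ suc (length qs) →
                count (A u) (concat ds) + count (A v) (concat ds) ≤ length (concat ds) →
                deg A u + deg A v < n
  degree-sum< qs ds cover↭ path-bound cycles-bound = begin-strict
    deg A u + deg A v                ≡⟨ cong₂ _+_ deg-u deg-v ⟩
    (cu + cuX) + (cv + cvX)          <⟨ s≤s (+-interchange-≤ cu cv cuX cvX path-bound′ cycles-bound) ⟩
    suc (suc (length qs) + length X) ≡⟨ sym n≡ ⟩
    n                                ∎
    where
    open ≤-Reasoning
    P = u ∷ qs ∷ʳ v
    X = concat ds
    cu = count (A u) (qs ∷ʳ v)
    cv = count (A v) (u ∷ qs)
    cuX = count (A u) X
    cvX = count (A v) X
    path-bound′ : cu + cv ≤ suc (length qs)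
    path-bound′ = subst (_≤ suc (length qs)) (+-comm cv cu) path-bound
    deg-split : ∀ w → deg A w ≡ count (A w) P + count (A w) X
    deg-split w = trans (count-↭ (A w) (↭-sym cover↭)) (count-++ (A w) P)
    deg-u : deg A u ≡ cu + cuX
    deg-u = trans (deg-split u) (cong (_+ cuX) (count-∷-false (A u) (qs ∷ʳ v) (irreflexive u)))
    deg-v : deg A v ≡ cv + cvX
    deg-v = trans (deg-split v) (cong (_+ cvX) (count-∷ʳ-false (A v) (u ∷ qs) (irreflexive v)))
    n≡ : n ≡ suc (suc (length qs) + length X)
    n≡ = begin-equality
      n                                ≡⟨ sym (length-tabulate id) ⟩
      length (allFin n)                ≡⟨ ↭-length (↭-sym cover↭) ⟩
      length (P ++ X)                  ≡⟨ length-++ P ⟩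
      length P + length X              ≡⟨ cong (λ k → suc k + length X) (↭-length (↭-sym (∷↭∷ʳ v qs))) ⟩
      suc (suc (length qs) + length X) ∎

  path-cover→cover : ∀ {r} → n ≤ deg A u + deg A v → HasPathCycleCoverAtMost A u v r → HasCycleCoverAtMost A r
  path-cover→cover n≤deg (qs , ds , path , cycs , cover↭ , ds<r) with crossing-or-count (A v) (A u) u qs v
  ... | inj₁ crossing with C , C↭ , cyc ← close-path qs path crossing =
    C ∷ ds , (cyc ∷ cycs , ↭-trans (++⁺ʳ (concat ds) C↭) cover↭) , ds<r
  ... | inj₂ path-bound with splices-or-count ds cycs
  ...   | inj₂ cycles-bound = ⊥-elim (<⇒≱ (degree-sum< qs ds cover↭ path-bound cycles-bound) n≤deg)
  ...   | inj₁ (_ , _ , _ , [] , _ , (vu , _)) with () ← trans (sym vu) v≁u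
  ...   | inj₁ (D , others , ds↭ , R@(_ ∷ _) , R↭ , arc) =
    (u ∷ qs ++ v ∷ R) ∷ others ,
    (inj₂ (length≥2 qs , subst (Chain A) (cong (u ∷_) (sym (++-assoc qs (v ∷ R) [ u ])))
                           (Chain-join (u ∷ qs) (R ∷ʳ u) path arc))
      ∷ All.tail (All-resp-↭ ds↭ cycs) ,
     ↭-trans (↭-reflexive merged≡)
       (↭-trans (++⁺ˡ (u ∷ qs ∷ʳ v) (↭-trans (++⁺ʳ (concat others) R↭) (concat-↭ (↭-sym ds↭)))) cover↭)) ,
    ≤-trans (≤-reflexive (↭-length (↭-sym ds↭))) (≤-trans (n≤1+n _) ds<r)
    where
    merged≡ : (u ∷ qs ++ v ∷ R) ++ concat others ≡ (u ∷ qs ∷ʳ v) ++ R ++ concat others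
    merged≡ = cong (u ∷_)
      (trans (++-assoc qs (v ∷ R) (concat others)) (sym (++-assoc qs [ v ] (R ++ concat others))))

addEdge-reflects-cover : ∀ {n} {A : Graph n} {u v r} → IsSimple A → u ≢ v → A u v ≡ false →
                         n ≤ deg A u + deg A v → HasCycleCoverAtMost (addEdge A u v) r → HasCycleCoverAtMost A r
addEdge-reflects-cover {A = A} {u} {v} simple u≢v u≁v n≤deg cover
  with Lowering.cover-lower A (IsSimple.symmetric simple) u v u≢v cover
... | inj₁ coverA    = coverA
... | inj₂ pathCover = Closing.path-cover→cover A simple u v u≁v n≤deg pathCover

ClosureSeq-reflects-cover : ∀ {n} {G H : Graph n} {r} → IsSimple G → ClosureSeq n G H →
                            HasCycleCoverAtMost H r → HasCycleCoverAtMost G r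
ClosureSeq-reflects-cover simple done cover = cover
ClosureSeq-reflects-cover simple (step u v u≢v u≁v n≤deg seq) cover =
  addEdge-reflects-cover simple u≢v u≁v n≤deg
    (ClosureSeq-reflects-cover (addEdge-isSimple u≢v simple) seq cover)

ClosureSeq-preserves-cover : ∀ {n k} {G H : Graph n} {r} → ClosureSeq k G H →
                             HasCycleCoverAtMost G r → HasCycleCoverAtMost H r
ClosureSeq-preserves-cover done cover = cover
ClosureSeq-preserves-cover {G = G} (step u v _ _ _ seq) cover =
  ClosureSeq-preserves-cover seq (HasCycleCoverAtMost-mono (addEdge-⊇ G u v) cover)

lemma1 : (n r : ℕ) → 1 ≤ r → (G H : Graph n) → IsSimple G →
         IsClosure n G H →
         (HasCycleCoverAtMost G r ⇔ HasCycleCoverAtMost H r)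
lemma1 n r _ G H simple (seq , _) = mk⇔ (ClosureSeq-preserves-cover seq) (ClosureSeq-reflects-cover simple seq)
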